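{- Let $e\geq 3$ be an integer and let $n$ be a positive integer with $n\equiv 2e \pmod{4e}$. If $n>2e$, there exists an $e$-star system of order $n$ which is $n$-block-colourable. If $n=2e$, every $e$-star system of order $2e$ is $(n-1)$-block-chromatic.
   Context: For an integer $e\ge 1$, an $e$-star is a copy of the complete bipartite graph $K_{1,e}$. An $e$-star system of order $n$ is a pair $(V,\mathcal{B})$ where $|V|=n$ and $\mathcal{B}$ is a set of $e$-stars (subgraphs of the complete graph $K_n$ on $V$) whose edge sets partition the edge set of $K_n$; the elements of $\mathcal B$ are called blocks. A block-colouring of such a system is a partition of $\mathcal{B}$ into colour classes such that the blocks in each colour class are pairwise vertex-disjoint. The system is $k$-block-colourable if it admits a block-colouring with $k$ colour classes, and $k$-block-chromatic if it is $k$-block-colourable but not $(k-1)$-block-colourable. -}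

module Defs where

open import Data.Nat using (ℕ; zero; suc; _+_; _*_; _≤_; _<_)
open import Data.Fin using (Fin)
open import Data.List using (List; _∷_; length)
open import Data.List.Relation.Unary.Unique.Propositional using (Unique)
open import Data.List.Membership.Propositional using (_∈_; _∉_)
open import Data.Product using (Σ; ∃; _×_; _,_)
open import Data.Sum using (_⊎_)
open import Data.Empty using (⊥)
open import Relation.Nullary using (¬_)
open import Relation.Binary.PropositionalEquality using (_≡_; _≢_)

record Star (n e : ℕ) : Set where
  constructor star
  field
    centre     : Fin n
    leaves     : List (Fin n)
    leavesLen  : length leaves ≡ e
    leavesUniq : Unique leaves
    centreNotLeaf : centre ∉ leaves
open Star public

EdgeOf : ∀ {n e} → Fin n → Fin n → Star n e → Set
EdgeOf u v s = (centre s ≡ u × v ∈ leaves s) ⊎ (centre s ≡ v × u ∈ leaves s)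

VertexOf : ∀ {n e} → Fin n → Star n e → Set
VertexOf v s = (v ≡ centre s) ⊎ (v ∈ leaves s)

record StarSystem (n e : ℕ) : Set where
  field
    m         : ℕ
    block     : Fin m → Star n e
    partition : ∀ (u v : Fin n) → u ≢ v →
                Σ (Fin m) λ i → EdgeOf u v (block i) ×
                  (∀ j → EdgeOf u v (block j) → j ≡ i)
open StarSystem public

VertexDisjoint : ∀ {n e} → Star n e → Star n e → Set
VertexDisjoint s t = ∀ v → VertexOf v s → VertexOf v t → ⊥

-- A block-colouring with k colour classes (classes may be empty):
-- blocks of the same colour are pairwise vertex-disjoint.
BlockColouring : ∀ {n e} → StarSystem n e → ℕ → Set
BlockColouring S k =
  Σ (Fin (m S) → Fin k) λ c →
    ∀ i j → i ≢ j → c i ≡ c j → VertexDisjoint (block S i) (block S j)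

Colourable : ∀ {n e} → StarSystem n e → ℕ → Set
Colourable S k = BlockColouring S k

-- k-block-chromatic: k-colourable but not (k-1)-colourable
-- (used with k ≥ 1 below).
Chromatic : ∀ {n e} → StarSystem n e → ℕ → Set
Chromatic S zero = Colourable S zero
Chromatic S (suc k) = Colourable S (suc k) × ¬ Colourable S k

-- n ≡ r (mod q) written as n = r + t*q for some t (valid when r < q)
CongMod : ℕ → ℕ → ℕ → Set
CongMod n r q = ∃ λ t → n ≡ r + t * q

-- Write n = (2t + 1)·2e and split the vertices into 2t + 1 groups of size 2e. Inside a group, a
-- point ∞ together with the rotational tournament on ℤ/(2e − 1) (a beats a + 1, …, a + e − 1)
-- decomposes K_{2e} into 2e − 1 stars: the star at a has the leaves ∞ and the points a beats.
-- Between groups g ≠ h, every vertex p of g is the centre of a star whose leaves form one half of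
-- group h, the half being chosen from the half containing p and the order of g and h so that each
-- cross edge is covered exactly once. Colour the inner star at (g, a) by (2g, a) and the cross star
-- at (g, p) towards h by (g + h, the order of g and h, the position of p in its half), with sums in
-- ℤ/(2t + 1). Two blocks of one colour that meet share a group, and then equal sums force them onto
-- the same pair of groups (2 being invertible modulo 2t + 1); there a direct check separates them.
--
-- For n = 2e, counting ordered pairs of distinct vertices gives 2e·m = 2e(2e − 1), so there are
-- m = n − 1 blocks, while two disjoint e-stars would need 2e + 2 > n vertices: every two blocks
-- meet, so all blocks need distinct colours.

module Submission where

open import Defs
open import Data.Nat using (ℕ; zero; suc; _+_; _*_; _∸_; _≤_; _<_; NonZero; >-nonZero; s≤s; z≤n; z<s)
open import Data.Nat.Properties
open import Data.Nat.DivMod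
open import Data.Nat.Divisibility using (_∣_; divides)
open import Data.Fin as Fin
  using (Fin; zero; suc; toℕ; fromℕ<; cast; splitAt; join; _↑ˡ_; _↑ʳ_; punchIn; punchOut)
import Data.Fin.Properties as Finₚ
open Finₚ using (toℕ<n; toℕ-fromℕ<; toℕ-injective; cast-involutive; +↔⊎; *↔×)
open import Data.List using (List; _∷_; lookup; tabulate)
open import Data.List.Properties using (length-tabulate; lookup-tabulate)
open import Data.List.Relation.Unary.All as All using ()
open import Data.List.Relation.Unary.AllPairs using (_∷_)
open import Data.List.Relation.Unary.Any using (index)
open import Data.List.Relation.Unary.Any.Properties using (lookup-index)
open import Data.List.Relation.Unary.Unique.Propositional using (Unique)
open import Data.List.Relation.Unary.Unique.Propositional.Properties using (tabulate⁺)
open import Data.List.Membership.Propositional using (_∈_)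
open import Data.List.Membership.Propositional.Properties using (∈-lookup; ∈-tabulate⁻)
open import Function using (_∘_; _↔_; _⇔_; mk⇔; Injective; Inverse; Injection; Equivalence)
open import Function.Properties.Inverse using (↔-refl; ↔-sym; ↔-trans; ↔⇒↣)
open import Function.Bundles using (mk↔ₛ′)
open import Data.Product.Function.NonDependent.Propositional using (_×-↔_)
open import Data.Sum.Function.Propositional using (_⊎-↔_)
open import Data.Product using (Σ; ∃; _×_; _,_; proj₁; proj₂; uncurry)
open import Data.Product.Properties using (×-≡,≡←≡)
open import Data.Sum as Sum using (_⊎_; inj₁; inj₂)
open import Relation.Binary.Definitions using (tri<; tri≈; tri>)
open import Data.Empty using (⊥-elim)
open import Relation.Nullary using (¬_; yes; no; does)
open import Relation.Nullary.Decidable using (dec-true; dec-false)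
open import Data.Bool using (Bool; true; false; not; _xor_)
open import Data.Bool.Properties using (not-¬; ¬-not; not-involutive; not-injective) renaming (_≟_ to _≟ᵇ_)
open import Relation.Binary.PropositionalEquality
open import Data.Nat.Tactic.RingSolver using (solve-∀)

module _ {d : ℕ} .{{_ : NonZero d}} where

  [m%d+n]%d≡[m+n]%d : ∀ m n → (m % d + n) % d ≡ (m + n) % d
  [m%d+n]%d≡[m+n]%d m n = begin
    (m % d + n) % d         ≡⟨ %-distribˡ-+ (m % d) n d ⟩
    (m % d % d + n % d) % d ≡⟨ cong (λ x → (x + n % d) % d) (m%n%n≡m%n m d) ⟩
    (m % d + n % d) % d     ≡⟨ %-distribˡ-+ m n d ⟨
    (m + n) % d             ∎
    where open ≡-Reasoning

  [m%d*n]%d≡[m*n]%d : ∀ m n → (m % d * n) % d ≡ (m * n) % d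
  [m%d*n]%d≡[m*n]%d m n = begin
    (m % d * n) % d         ≡⟨ %-distribˡ-* (m % d) n d ⟩
    (m % d % d * (n % d)) % d ≡⟨ cong (λ x → (x * (n % d)) % d) (m%n%n≡m%n m d) ⟩
    (m % d * (n % d)) % d   ≡⟨ %-distribˡ-* m n d ⟨
    (m * n) % d             ∎
    where open ≡-Reasoning

  +-%-cancelˡ : ∀ x {m n} → m < d → n < d → (x + m) % d ≡ (x + n) % d → m ≡ n
  +-%-cancelˡ x {m} {n} m<d n<d eq = begin
    m                     ≡⟨ untranslate m<d ⟨
    (y + (x + m) % d) % d ≡⟨ cong (λ z → (y + z) % d) eq ⟩
    (y + (x + n) % d) % d ≡⟨ untranslate n<d ⟩
    n                     ∎
    where
    open ≡-Reasoning
    y = d ∸ x % d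
    d∣y+x : d ∣ y + x
    d∣y+x = divides (suc (x / d)) (begin
      y + x                   ≡⟨ cong (y +_) (m≡m%n+[m/n]*n x d) ⟩
      y + (x % d + x / d * d) ≡⟨ +-assoc y (x % d) _ ⟨
      y + x % d + x / d * d   ≡⟨ cong (_+ x / d * d) (m∸n+n≡m (m%n≤n x d)) ⟩
      d + x / d * d           ∎)
    untranslate : ∀ {m} → m < d → (y + (x + m) % d) % d ≡ m
    untranslate {m} m<d = begin
      (y + (x + m) % d) % d ≡⟨ cong (_% d) (+-comm y _) ⟩
      ((x + m) % d + y) % d ≡⟨ [m%d+n]%d≡[m+n]%d (x + m) y ⟩
      (x + m + y) % d       ≡⟨ cong (_% d) (trans (+-comm (x + m) y) (sym (+-assoc y x m))) ⟩
      (y + x + m) % d       ≡⟨ %-remove-+ˡ m d∣y+x ⟩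
      m % d                 ≡⟨ m<n⇒m%n≡m m<d ⟩
      m                     ∎

-- multiplying by t + 1, the inverse of 2 modulo 2t + 1, undoes the doubling
double-%-injective : ∀ t {m n} → m < suc (t + t) → n < suc (t + t) →
                     (m + m) % suc (t + t) ≡ (n + n) % suc (t + t) → m ≡ n
double-%-injective t {m} {n} m<d n<d eq = begin
  m                          ≡⟨ halve m<d ⟨
  ((m + m) % d * suc t) % d  ≡⟨ cong (λ z → (z * suc t) % d) eq ⟩
  ((n + n) % d * suc t) % d  ≡⟨ halve n<d ⟩
  n                          ∎
  where
  open ≡-Reasoning
  d = suc (t + t)
  double-times-half : ∀ t m → (m + m) * suc t ≡ m + m * suc (t + t)
  double-times-half = solve-∀
  halve : ∀ {m} → m < d → ((m + m) % d * suc t) % d ≡ m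
  halve {m} m<d = begin
    ((m + m) % d * suc t) % d ≡⟨ [m%d*n]%d≡[m*n]%d (m + m) (suc t) ⟩
    ((m + m) * suc t) % d     ≡⟨ cong (_% d) (double-times-half t m) ⟩
    (m + m * d) % d           ≡⟨ [m+kn]%n≡m%n m m d ⟩
    m % d                     ≡⟨ m<n⇒m%n≡m m<d ⟩
    m                         ∎

module _ {d : ℕ} .{{_ : NonZero d}} where

  mod-injective : ∀ {m n} → m mod d ≡ n mod d → m % d ≡ n % d
  mod-injective {m} {n} eq =
    trans (sym (toℕ-fromℕ< (m%n<n m d))) (trans (cong toℕ eq) (toℕ-fromℕ< (m%n<n n d)))

  infixl 6 _⊕_
  _⊕_ : Fin d → Fin d → Fin d
  a ⊕ b = (toℕ a + toℕ b) mod d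

  ⊕-comm : ∀ a b → a ⊕ b ≡ b ⊕ a
  ⊕-comm a b = cong (_mod d) (+-comm (toℕ a) (toℕ b))

  ⊕-cancelˡ : ∀ a {b c} → a ⊕ b ≡ a ⊕ c → b ≡ c
  ⊕-cancelˡ a {b} {c} eq =
    toℕ-injective (+-%-cancelˡ (toℕ a) (toℕ<n b) (toℕ<n c) (mod-injective eq))

  ⊕-determines-pair : ∀ {x g h g' h'} → x ≡ g ⊎ x ≡ h → x ≡ g' ⊎ x ≡ h' → g ⊕ h ≡ g' ⊕ h' →
                      (g ≡ g' × h ≡ h') ⊎ (g ≡ h' × h ≡ g')
  ⊕-determines-pair {x} (inj₁ refl) (inj₁ refl) eq = inj₁ (refl , ⊕-cancelˡ x eq)
  ⊕-determines-pair {x} {g' = g'} (inj₁ refl) (inj₂ refl) eq =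
    inj₂ (refl , ⊕-cancelˡ x (trans eq (⊕-comm g' x)))
  ⊕-determines-pair {x} {g} (inj₂ refl) (inj₁ refl) eq =
    inj₂ (⊕-cancelˡ x (trans (⊕-comm x g) eq) , refl)
  ⊕-determines-pair {x} {g} {g' = g'} (inj₂ refl) (inj₂ refl) eq =
    inj₁ (⊕-cancelˡ x (trans (⊕-comm x g) (trans eq (⊕-comm g' x))) , refl)

⊕-double-injective : ∀ {t} {a b : Fin (suc (t + t))} → a ⊕ a ≡ b ⊕ b → a ≡ b
⊕-double-injective {t} {a} {b} eq =
  toℕ-injective (double-%-injective t (toℕ<n a) (toℕ<n b)
    (mod-injective {m = toℕ a + toℕ a} {toℕ b + toℕ b} eq))

module Rotational (k : ℕ) where

  N : ℕ
  N = k + suc k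

  k<N : k < N
  k<N = m<m+n k z<s

  instance
    N-nonZero : NonZero N
    N-nonZero = >-nonZero (≤-<-trans z≤n k<N)

  shift : Fin N → Fin k → Fin N
  shift a j = (toℕ a + suc (toℕ j)) mod N

  _⟶_ : Fin N → Fin N → Set
  a ⟶ b = ∃ λ j → shift a j ≡ b

  private
    Arcℕ : ℕ → ℕ → Set
    Arcℕ a b = ∃ λ (j : Fin k) → (a + suc (toℕ j)) % N ≡ b

    toℕ-shift : ∀ a j → toℕ (shift a j) ≡ (toℕ a + suc (toℕ j)) % N
    toℕ-shift a j = toℕ-fromℕ< (m%n<n _ N)

    arcℕ⇒⟶ : ∀ {a b} → Arcℕ (toℕ a) (toℕ b) → a ⟶ b
    arcℕ⇒⟶ {a} (j , eq) = j , toℕ-injective (trans (toℕ-shift a j) eq)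

    1+j<N : ∀ (j : Fin k) → suc (toℕ j) < N
    1+j<N j = ≤-<-trans (toℕ<n j) k<N

    toℕ≡[toℕ+0]%N : ∀ (a : Fin N) → toℕ a ≡ (toℕ a + 0) % N
    toℕ≡[toℕ+0]%N a = sym (trans (cong (_% N) (+-identityʳ (toℕ a))) (m<n⇒m%n≡m (toℕ<n a)))

  shift-injective : ∀ a {j j'} → shift a j ≡ shift a j' → j ≡ j'
  shift-injective a {j} {j'} eq =
    toℕ-injective (suc-injective (+-%-cancelˡ (toℕ a) (1+j<N j) (1+j<N j') (mod-injective eq)))

  shift-≢ : ∀ a j → shift a j ≢ a
  shift-≢ a j eq = 1+n≢0 (+-%-cancelˡ (toℕ a) (1+j<N j) (≤-<-trans z≤n k<N)
    (trans (sym (toℕ-shift a j)) (trans (cong toℕ eq) (toℕ≡[toℕ+0]%N a))))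

  ⟶-asym : ∀ {a b} → a ⟶ b → ¬ b ⟶ a
  ⟶-asym {a} {b} (j , refl) (j' , eq) = 1+n≢0 (+-%-cancelˡ (toℕ a) steps<N (≤-<-trans z≤n k<N) (begin
    (toℕ a + (suc (toℕ j) + suc (toℕ j'))) % N ≡⟨ cong (_% N) (+-assoc (toℕ a) _ _) ⟨
    (toℕ a + suc (toℕ j) + suc (toℕ j')) % N   ≡⟨ [m%d+n]%d≡[m+n]%d (toℕ a + suc (toℕ j)) _ ⟨
    ((toℕ a + suc (toℕ j)) % N + suc (toℕ j')) % N ≡⟨ cong (λ z → (z + suc (toℕ j')) % N) (toℕ-shift a j) ⟨
    (toℕ (shift a j) + suc (toℕ j')) % N         ≡⟨ toℕ-shift (shift a j) j' ⟨
    toℕ (shift (shift a j) j')                   ≡⟨ cong toℕ eq ⟩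
    toℕ a                                        ≡⟨ toℕ≡[toℕ+0]%N a ⟩
    (toℕ a + 0) % N                              ∎))
    where
    open ≡-Reasoning
    steps<N : suc (toℕ j) + suc (toℕ j') < N
    steps<N = ≤-<-trans (+-mono-≤ (toℕ<n j) (toℕ<n j')) (+-monoʳ-< k (n<1+n k))

  private
    wrap : ∀ a k r j → suc a + (k + r) + suc j ≡ a + (k + suc (suc r + j))
    wrap = solve-∀

    regroup : ∀ a k r → suc a + (k + r) ≡ k + suc (a + r)
    regroup = solve-∀

    arc-or-back : ∀ {a b} → a < b → b < N → Arcℕ a b ⊎ Arcℕ b a
    arc-or-back {a} a<b b<N with m≤n⇒∃[o]m+o≡n a<b
    ... | δ , refl with δ <? k
    ...   | yes δ<k = inj₁ (fromℕ< δ<k , (begin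
      (a + suc (toℕ (fromℕ< δ<k))) % N ≡⟨ cong (λ z → (a + suc z) % N) (toℕ-fromℕ< δ<k) ⟩
      (a + suc δ) % N                  ≡⟨ cong (_% N) (+-suc a δ) ⟩
      (suc a + δ) % N                  ≡⟨ m<n⇒m%n≡m b<N ⟩
      suc a + δ                        ∎))
      where open ≡-Reasoning
    ...   | no δ≮k with m≤n⇒∃[o]m+o≡n (≮⇒≥ δ≮k)
    ...     | r , refl with m≤n⇒∃[o]m+o≡n r<k
      where
      r<k : r < k
      r<k = ≤-trans (s≤s (m≤n+m r a))
              (≤-pred (+-cancelˡ-< k _ _ (subst (_< N) (regroup a k r) b<N)))
    ...       | j , k≡1+r+j = inj₂ (fromℕ< j<k , (begin
      (suc a + (k + r) + suc (toℕ (fromℕ< j<k))) % N ≡⟨ cong (λ z → (suc a + (k + r) + suc z) % N) (toℕ-fromℕ< j<k) ⟩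
      (suc a + (k + r) + suc j) % N                  ≡⟨ cong (_% N) (wrap a k r j) ⟩
      (a + (k + suc (suc r + j))) % N                ≡⟨ cong (λ z → (a + (k + suc z)) % N) k≡1+r+j ⟩
      (a + N) % N                                    ≡⟨ [m+n]%n≡m%n a N ⟩
      a % N                                          ≡⟨ m<n⇒m%n≡m (<-trans (s≤s (m≤m+n a _)) b<N) ⟩
      a                                              ∎))
      where
      open ≡-Reasoning
      j<k : j < k
      j<k = subst (j <_) k≡1+r+j (s≤s (m≤n+m j r))

  ⟶-total : ∀ {a b} → a ≢ b → a ⟶ b ⊎ b ⟶ a
  ⟶-total {a} {b} a≢b with <-cmp (toℕ a) (toℕ b)
  ... | tri≈ _ a≡b _ = ⊥-elim (a≢b (toℕ-injective a≡b))
  ... | tri< a<b _ _ = Sum.map arcℕ⇒⟶ arcℕ⇒⟶ (arc-or-back a<b (toℕ<n b))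
  ... | tri> _ _ b<a = Sum.swap (Sum.map arcℕ⇒⟶ arcℕ⇒⟶ (arc-or-back b<a (toℕ<n a)))


-- A star on a vertex type X is given by the injective listing of its vertices, centre first.
module _ {X : Set} {e : ℕ} where

  Joins : (Fin (suc e) → X) → X → X → Set
  Joins f x y = f zero ≡ x × ∃ λ j → f (suc j) ≡ y

  Covers : (Fin (suc e) → X) → X → X → Set
  Covers f x y = Joins f x y ⊎ Joins f y x

  Disjoint : (Fin (suc e) → X) → (Fin (suc e) → X) → Set
  Disjoint f g = ∀ i j → f i ≢ g j

  module _ {B : Set} (listing : B → Fin (suc e) → X) where

    Owns : B → X → X → Set
    Owns b x y = Covers (listing b) x y × (∀ b' → Covers (listing b') x y → b' ≡ b)

    Decomposes : Set
    Decomposes = ∀ x y → x ≢ y → ∃ λ b → Owns b x y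

    owns-sym : ∀ {b x y} → Owns b x y → Owns b y x
    owns-sym (covers , unique) = Sum.swap covers , λ b' → unique b' ∘ Sum.swap

lookup-injective : ∀ {A : Set} {xs : List A} → Unique xs → ∀ i j → lookup xs i ≡ lookup xs j → i ≡ j
lookup-injective (_ ∷ _) zero zero _ = refl
lookup-injective (x∉ ∷ _) zero (suc j) eq = ⊥-elim (All.lookup x∉ (∈-lookup j) eq)
lookup-injective (x∉ ∷ _) (suc i) zero eq = ⊥-elim (All.lookup x∉ (∈-lookup i) (sym eq))
lookup-injective (_ ∷ u) (suc i) (suc j) eq = cong suc (lookup-injective u i j eq)

module _ {n e : ℕ} where

  leaf : Star n e → Fin e → Fin n
  leaf s j = lookup (leaves s) (cast (sym (leavesLen s)) j)

  vertex : Star n e → Fin (suc e) → Fin n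
  vertex s zero = centre s
  vertex s (suc j) = leaf s j

  ∈⇒leaf : ∀ s {v} → v ∈ leaves s → ∃ λ j → leaf s j ≡ v
  ∈⇒leaf s v∈ = cast (leavesLen s) (index v∈) , (begin
    lookup (leaves s) (cast (sym (leavesLen s)) (cast (leavesLen s) (index v∈)))
      ≡⟨ cong (lookup (leaves s)) (cast-involutive (sym (leavesLen s)) (leavesLen s) (index v∈)) ⟩
    lookup (leaves s) (index v∈) ≡⟨ lookup-index v∈ ⟨
    _ ∎)
    where open ≡-Reasoning

  leaf-injective : ∀ s → Injective _≡_ _≡_ (leaf s)
  leaf-injective s {j} {j'} eq = begin
    j                                                    ≡⟨ cast-involutive (leavesLen s) (sym (leavesLen s)) j ⟨
    cast (leavesLen s) (cast (sym (leavesLen s)) j)      ≡⟨ cong (cast (leavesLen s)) (lookup-injective (leavesUniq s) _ _ eq) ⟩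
    cast (leavesLen s) (cast (sym (leavesLen s)) j')     ≡⟨ cast-involutive (leavesLen s) (sym (leavesLen s)) j' ⟩
    j'                                                   ∎
    where open ≡-Reasoning

  centre≢leaf : ∀ s j → centre s ≢ leaf s j
  centre≢leaf s j eq = centreNotLeaf s (subst (_∈ leaves s) (sym eq) (∈-lookup _))

  vertex-injective : ∀ s → Injective _≡_ _≡_ (vertex s)
  vertex-injective s {zero} {zero} _ = refl
  vertex-injective s {zero} {suc j} eq = ⊥-elim (centre≢leaf s j eq)
  vertex-injective s {suc i} {zero} eq = ⊥-elim (centre≢leaf s i (sym eq))
  vertex-injective s {suc i} {suc j} eq = cong suc (leaf-injective s eq)

  module _ (s : Star n e) {f : Fin (suc e) → Fin n} (vertex≗f : ∀ i → vertex s i ≡ f i) where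

    vertexOf⇔ : ∀ {v} → VertexOf v s ⇔ ∃ λ i → f i ≡ v
    vertexOf⇔ = mk⇔ to from
      where
      to : ∀ {v} → VertexOf v s → ∃ λ i → f i ≡ v
      to (inj₁ refl) = zero , sym (vertex≗f zero)
      to (inj₂ v∈) = let j , eq = ∈⇒leaf s v∈ in suc j , trans (sym (vertex≗f (suc j))) eq
      from : ∀ {v} → ∃ (λ i → f i ≡ v) → VertexOf v s
      from (zero , refl) = inj₁ (sym (vertex≗f zero))
      from (suc j , refl) = inj₂ (subst (_∈ leaves s) (vertex≗f (suc j)) (∈-lookup _))

    edgeOf⇔ : ∀ {u v} → EdgeOf u v s ⇔ Covers f u v
    edgeOf⇔ = mk⇔ (Sum.map to to) (Sum.map from from)
      where
      to : ∀ {u v} → centre s ≡ u × v ∈ leaves s → Joins f u v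
      to (refl , v∈) = let j , eq = ∈⇒leaf s v∈ in
        sym (vertex≗f zero) , j , trans (sym (vertex≗f (suc j))) eq
      from : ∀ {u v} → Joins f u v → centre s ≡ u × v ∈ leaves s
      from (refl , j , refl) = vertex≗f zero , subst (_∈ leaves s) (vertex≗f (suc j)) (∈-lookup _)

  fromVertices : (f : Fin (suc e) → Fin n) → Injective _≡_ _≡_ f → Star n e
  fromVertices f f-inj = star (f zero) (tabulate (f ∘ suc)) (length-tabulate (f ∘ suc))
    (tabulate⁺ (λ eq → Finₚ.suc-injective (f-inj eq)))
    (λ f0∈ → let j , eq = ∈-tabulate⁻ f0∈ in Finₚ.0≢1+n (f-inj eq))

  vertex-fromVertices : ∀ f (f-inj : Injective _≡_ _≡_ f) i → vertex (fromVertices f f-inj) i ≡ f i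
  vertex-fromVertices f f-inj zero = refl
  vertex-fromVertices f f-inj (suc j) = lookup-tabulate (f ∘ suc) j


module _ {A X : Set} (iso : A ↔ X) where

  open Inverse iso

  from-injective : Injective _≡_ _≡_ from
  from-injective = Injection.injective (↔⇒↣ (↔-sym iso))

  to-injective : Injective _≡_ _≡_ to
  to-injective = Injection.injective (↔⇒↣ iso)

  covers-from⇔ : ∀ {e} {f : Fin (suc e) → X} {a b} → Covers (from ∘ f) a b ⇔ Covers f (to a) (to b)
  covers-from⇔ {f = f} = mk⇔ (Sum.map pull pull) (Sum.map push push)
    where
    pull : ∀ {a b} → Joins (from ∘ f) a b → Joins f (to a) (to b)
    pull (c , j , l) =
      trans (sym (strictlyInverseˡ _)) (cong to c) , j , trans (sym (strictlyInverseˡ _)) (cong to l)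
    push : ∀ {a b} → Joins f (to a) (to b) → Joins (from ∘ f) a b
    push (c , j , l) = trans (cong from c) (strictlyInverseʳ _) , j , trans (cong from l) (strictlyInverseʳ _)

module _ {X B : Set} {n m e : ℕ} (vertices : Fin n ↔ X) (blocks : Fin m ↔ B)
         (listing : B → Fin (suc e) → X) (listing-injective : ∀ b → Injective _≡_ _≡_ (listing b)) where

  private
    module V = Inverse vertices
    module Bl = Inverse blocks

    encoded-injective : ∀ b → Injective _≡_ _≡_ (V.from ∘ listing b)
    encoded-injective b = listing-injective b ∘ from-injective vertices

    blockStar : B → Star n e
    blockStar b = fromVertices (V.from ∘ listing b) (encoded-injective b)

    vertex-blockStar : ∀ b i → vertex (blockStar b) i ≡ V.from (listing b i)
    vertex-blockStar b = vertex-fromVertices (V.from ∘ listing b) (encoded-injective b)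

    edgeOf-blockStar⇔ : ∀ {b u v} → EdgeOf u v (blockStar b) ⇔ Covers (listing b) (V.to u) (V.to v)
    edgeOf-blockStar⇔ {b} = mk⇔ (to covers ∘ to edge) (from edge ∘ from covers)
      where
      open Equivalence
      edge = edgeOf⇔ (blockStar b) (vertex-blockStar b)
      covers = covers-from⇔ vertices {f = listing b}

  starSystem : Decomposes listing → StarSystem n e
  starSystem decomposes = record { m = m ; block = blockStar ∘ Bl.to ; partition = owner }
    where
    owner : ∀ u v → u ≢ v → Σ (Fin m) λ i → EdgeOf u v (blockStar (Bl.to i)) ×
                                             (∀ j → EdgeOf u v (blockStar (Bl.to j)) → j ≡ i)
    owner u v u≢v with decomposes (V.to u) (V.to v) (u≢v ∘ to-injective vertices)
    ... | b , covers , unique = Bl.from b ,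
      Equivalence.from edgeOf-blockStar⇔ (subst (λ b → Covers (listing b) _ _) (sym (Bl.strictlyInverseˡ b)) covers) ,
      λ j edge → trans (sym (Bl.strictlyInverseʳ j))
                       (cong Bl.from (unique (Bl.to j) (Equivalence.to edgeOf-blockStar⇔ edge)))

  starSystem-colourable : ∀ {k} (decomposes : Decomposes listing) (c : B → Fin k) →
    (∀ b b' → b ≢ b' → c b ≡ c b' → Disjoint (listing b) (listing b')) → Colourable (starSystem decomposes) k
  starSystem-colourable decomposes c classes-disjoint = c ∘ Bl.to , λ i j i≢j same-colour v v∈i v∈j →
    let x , ex = Equivalence.to (vertexOf⇔ (blockStar (Bl.to i)) (vertex-blockStar (Bl.to i))) v∈i
        y , ey = Equivalence.to (vertexOf⇔ (blockStar (Bl.to j)) (vertex-blockStar (Bl.to j))) v∈j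
    in classes-disjoint (Bl.to i) (Bl.to j) (i≢j ∘ to-injective blocks) same-colour x y
         (from-injective vertices (trans ex (sym ey)))


xor-exclusive : ∀ o a → a ≢ not o xor (o xor a)
xor-exclusive false a = not-¬ refl
xor-exclusive true a = not-¬ refl

xor-cancelˡ : ∀ o {a b} → o xor a ≡ o xor b → a ≡ b
xor-cancelˡ false = λ eq → eq
xor-cancelˡ true = not-injective

xor-dichotomy : ∀ o a b → b ≢ o xor a → a ≡ not o xor b
xor-dichotomy false a b b≢a = ¬-not (b≢a ∘ sym)
xor-dichotomy true a b b≢¬a = sym (trans (¬-not b≢¬a) (not-involutive a))

module _ {n : ℕ} where

  orient : Fin n → Fin n → Bool
  orient g h = does (g Finₚ.<? h)

  orient-flip : ∀ {g h} → g ≢ h → orient h g ≡ not (orient g h)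
  orient-flip {g} {h} g≢h with Finₚ.<-cmp g h
  ... | tri< g<h _ h≮g = trans (dec-false (h Finₚ.<? g) h≮g) (cong not (sym (dec-true (g Finₚ.<? h) g<h)))
  ... | tri≈ _ g≡h _ = ⊥-elim (g≢h g≡h)
  ... | tri> g≮h _ h<g = trans (dec-true (h Finₚ.<? g) h<g) (cong not (sym (dec-false (g Finₚ.<? h) g≮h)))

module Halves (e : ℕ) where

  half : Bool → Fin e → Fin (e + e)
  half false y = y ↑ˡ e
  half true y = e ↑ʳ y

  unhalf : Fin (e + e) → Bool × Fin e
  unhalf p = Sum.[ (false ,_) , (true ,_) ]′ (splitAt e p)

  side : Fin (e + e) → Bool
  side = proj₁ ∘ unhalf

  position : Fin (e + e) → Fin e
  position = proj₂ ∘ unhalf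

  unhalf-half : ∀ b y → unhalf (half b y) ≡ (b , y)
  unhalf-half false y = cong Sum.[ (false ,_) , (true ,_) ]′ (Finₚ.splitAt-↑ˡ e y e)
  unhalf-half true y = cong Sum.[ (false ,_) , (true ,_) ]′ (Finₚ.splitAt-↑ʳ e e y)

  half-unhalf : ∀ p → half (side p) (position p) ≡ p
  half-unhalf p = trans (join-view (splitAt e p)) (Finₚ.join-splitAt e e p)
    where
    join-view : ∀ v → uncurry half (Sum.[ (false ,_) , (true ,_) ]′ v) ≡ join e e v
    join-view (inj₁ y) = refl
    join-view (inj₂ y) = refl

  half-injective : ∀ b b' {y y'} → half b y ≡ half b' y' → b ≡ b' × y ≡ y'
  half-injective b b' {y} {y'} eq =
    ×-≡,≡←≡ (trans (sym (unhalf-half b y)) (trans (cong unhalf eq) (unhalf-half b' y')))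

-- zero is the point ∞ adjoined to ℤ/(2k + 1)
module Complete (k : ℕ) where

  open Rotational k public

  innerVertex : Fin N → Fin (suc (suc k)) → Fin (suc N)
  innerVertex a zero = suc a
  innerVertex a (suc zero) = zero
  innerVertex a (suc (suc j)) = suc (shift a j)

  innerVertex-injective : ∀ a → Injective _≡_ _≡_ (innerVertex a)
  innerVertex-injective a {zero} {zero} _ = refl
  innerVertex-injective a {zero} {suc (suc j)} eq = ⊥-elim (shift-≢ a j (sym (Finₚ.suc-injective eq)))
  innerVertex-injective a {suc zero} {suc zero} _ = refl
  innerVertex-injective a {suc (suc i)} {zero} eq = ⊥-elim (shift-≢ a i (Finₚ.suc-injective eq))
  innerVertex-injective a {suc (suc i)} {suc (suc j)} eq =
    cong (λ j → suc (suc j)) (shift-injective a (Finₚ.suc-injective eq))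

  private
    joins⁻ : ∀ {a c b} → Joins (innerVertex a) (suc c) (suc b) → a ≡ c × a ⟶ b
    joins⁻ (refl , suc j , eq) = refl , j , Finₚ.suc-injective eq

    owns-∞ : ∀ a → Owns innerVertex a (suc a) zero
    owns-∞ a = inj₁ (refl , zero , refl) , unique
      where
      unique : ∀ a' → Covers (innerVertex a') (suc a) zero → a' ≡ a
      unique a' (inj₁ (eq , _)) = Finₚ.suc-injective eq

    owns-⟶ : ∀ {a b} → a ⟶ b → Owns innerVertex a (suc a) (suc b)
    owns-⟶ {a} {b} (j , eq) = inj₁ (refl , suc j , cong suc eq) , unique
      where
      unique : ∀ a' → Covers (innerVertex a') (suc a) (suc b) → a' ≡ a
      unique a' (inj₁ joins) = proj₁ (joins⁻ joins)
      unique a' (inj₂ joins) with joins⁻ joins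
      ... | refl , b⟶a = ⊥-elim (⟶-asym (j , eq) b⟶a)

  innerVertex-decomposes : Decomposes innerVertex
  innerVertex-decomposes zero zero ∞≢∞ = ⊥-elim (∞≢∞ refl)
  innerVertex-decomposes zero (suc b) _ = b , owns-sym innerVertex (owns-∞ b)
  innerVertex-decomposes (suc a) zero _ = a , owns-∞ a
  innerVertex-decomposes (suc a) (suc b) a≢b with ⟶-total (a≢b ∘ cong suc)
  ... | inj₁ a⟶b = a , owns-⟶ a⟶b
  ... | inj₂ b⟶a = b , owns-sym innerVertex (owns-⟶ b⟶a)

module Construction (t k : ℕ) where

  open Complete k

  e s : ℕ
  e = suc k
  s = suc (t + t)

  open Halves e

  data Block : Set where
    inner : Fin s → Fin N → Block
    cross : Fin s → Fin (e + e) → Fin (t + t) → Block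

  listing : Block → Fin (suc e) → Fin s × Fin (e + e)
  listing (inner g a) i = g , innerVertex a i
  listing (cross g p h) zero = g , p
  listing (cross g p h) (suc y) = punchIn g h , half (orient g (punchIn g h) xor side p) y

  Claims : Fin s → Fin s → Fin (e + e) → Fin (e + e) → Set
  Claims g h x y = side y ≡ orient g h xor side x

  claims-exclusive : ∀ {g h x y} → g ≢ h → Claims g h x y → ¬ Claims h g y x
  claims-exclusive {g} {h} {x} {y} g≢h claims claims' = xor-exclusive (orient g h) (side x) (begin
    side x                        ≡⟨ claims' ⟩
    orient h g xor side y         ≡⟨ cong (_xor side y) (orient-flip g≢h) ⟩
    not (orient g h) xor side y   ≡⟨ cong (not (orient g h) xor_) claims ⟩
    not (orient g h) xor (orient g h xor side x) ∎)
    where open ≡-Reasoning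

  claims-dichotomy : ∀ {g h x y} → g ≢ h → ¬ Claims g h x y → Claims h g y x
  claims-dichotomy {g} {h} {x} {y} g≢h ¬claims =
    subst (λ o → side x ≡ o xor side y) (sym (orient-flip g≢h))
      (xor-dichotomy (orient g h) (side x) (side y) ¬claims)

  listing-injective : ∀ b → Injective _≡_ _≡_ (listing b)
  listing-injective (inner g a) eq = innerVertex-injective a (cong proj₂ eq)
  listing-injective (cross g p h) {zero} {zero} _ = refl
  listing-injective (cross g p h) {zero} {suc y} eq = ⊥-elim (Finₚ.punchInᵢ≢i g h (sym (cong proj₁ eq)))
  listing-injective (cross g p h) {suc y} {zero} eq = ⊥-elim (Finₚ.punchInᵢ≢i g h (cong proj₁ eq))
  listing-injective (cross g p h) {suc y} {suc y'} eq = cong suc (proj₂ (half-injective β β (cong proj₂ eq)))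
    where β = orient g (punchIn g h) xor side p

  private
    covers-inner⁻ : ∀ {g a g₁ g₂ x y} → Covers (listing (inner g a)) (g₁ , x) (g₂ , y) →
                    g₁ ≡ g × g₂ ≡ g × Covers (innerVertex a) x y
    covers-inner⁻ (inj₁ (refl , j , refl)) = refl , refl , inj₁ (refl , j , refl)
    covers-inner⁻ (inj₂ (refl , j , refl)) = refl , refl , inj₂ (refl , j , refl)

    covers-cross⇒≢ : ∀ {g p h g₁ g₂ x y} → Covers (listing (cross g p h)) (g₁ , x) (g₂ , y) → g₁ ≢ g₂
    covers-cross⇒≢ {g} {h = h} (inj₁ (refl , j , refl)) = Finₚ.punchInᵢ≢i g h ∘ sym
    covers-cross⇒≢ {g} {h = h} (inj₂ (refl , j , refl)) = Finₚ.punchInᵢ≢i g h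

    joins-cross⁻ : ∀ {g p h g₁ g₂ x y} → Joins (listing (cross g p h)) (g₁ , x) (g₂ , y) →
                   g₁ ≡ g × x ≡ p × g₂ ≡ punchIn g h × Claims g g₂ p y
    joins-cross⁻ (refl , j , refl) = refl , refl , refl , cong proj₁ (unhalf-half _ j)

    owns-inner : ∀ {g a x y} → Owns innerVertex a x y → Owns listing (inner g a) (g , x) (g , y)
    owns-inner {g} {a} {x} {y} (covers , unique) = Sum.map lift lift covers , unique′
      where
      lift : ∀ {a x y} → Joins (innerVertex a) x y → Joins (listing (inner g a)) (g , x) (g , y)
      lift (c , j , l) = cong (g ,_) c , j , cong (g ,_) l
      unique′ : ∀ b → Covers (listing b) (g , x) (g , y) → b ≡ inner g a
      unique′ (inner g' a') covers' with covers-inner⁻ covers'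
      ... | refl , _ , local = cong (inner g) (unique a' local)
      unique′ (cross g' p h) covers' = ⊥-elim (covers-cross⇒≢ covers' refl)

    owns-cross : ∀ {g₁ g₂ x y} (g₁≢g₂ : g₁ ≢ g₂) → Claims g₁ g₂ x y →
                 Owns listing (cross g₁ x (punchOut g₁≢g₂)) (g₁ , x) (g₂ , y)
    owns-cross {g₁} {g₂} {x} {y} g₁≢g₂ rule = inj₁ (refl , position y , reaches-y) , unique
      where
      h = punchOut g₁≢g₂
      reaches-y : listing (cross g₁ x h) (suc (position y)) ≡ (g₂ , y)
      reaches-y rewrite Finₚ.punchIn-punchOut g₁≢g₂ =
        cong (g₂ ,_) (trans (cong (λ b → half b (position y)) (sym rule)) (half-unhalf y))
      unique : ∀ b → Covers (listing b) (g₁ , x) (g₂ , y) → b ≡ cross g₁ x h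
      unique (inner g a) covers with covers-inner⁻ covers
      ... | refl , refl , _ = ⊥-elim (g₁≢g₂ refl)
      unique (cross g p h') (inj₁ joins) with joins-cross⁻ joins
      ... | refl , refl , g₂≡ , _ = cong (cross g₁ x) (Finₚ.punchIn-injective g₁ h' h
        (trans (sym g₂≡) (sym (Finₚ.punchIn-punchOut g₁≢g₂))))
      unique (cross g p h') (inj₂ joins) with joins-cross⁻ joins
      ... | refl , refl , refl , rule' = ⊥-elim (claims-exclusive {x = x} {y} g₁≢g₂ rule rule')

  listing-decomposes : Decomposes listing
  listing-decomposes (g₁ , x) (g₂ , y) neq with g₁ Finₚ.≟ g₂
  ... | yes refl =
    let a , owns = innerVertex-decomposes x y (neq ∘ cong (g₁ ,_)) in inner g₁ a , owns-inner owns
  ... | no g₁≢g₂ with side y ≟ᵇ orient g₁ g₂ xor side x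
  ...   | yes claims = cross g₁ x _ , owns-cross g₁≢g₂ claims
  ...   | no ¬claims = cross g₂ y _ ,
    owns-sym listing (owns-cross (g₁≢g₂ ∘ sym) (claims-dichotomy {x = x} {y} g₁≢g₂ ¬claims))

  colour : Block → Fin s × Fin (e + e)
  colour (inner g a) = g ⊕ g , suc a
  colour (cross g p h) = g ⊕ punchIn g h , half (orient g (punchIn g h)) (position p)

  private
    ends : Block → Fin s × Fin s
    ends (inner g a) = g , g
    ends (cross g p h) = g , punchIn g h

    listing-ends : ∀ b i → proj₁ (listing b i) ≡ proj₁ (ends b) ⊎ proj₁ (listing b i) ≡ proj₂ (ends b)
    listing-ends (inner g a) i = inj₁ refl
    listing-ends (cross g p h) zero = inj₁ refl
    listing-ends (cross g p h) (suc y) = inj₂ refl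

    colour-ends : ∀ b → proj₁ (colour b) ≡ uncurry _⊕_ (ends b)
    colour-ends (inner g a) = refl
    colour-ends (cross g p h) = refl

    -- the leaves of the two stars lie in complementary halves of group h
    cross-disjoint : ∀ {g h p p'} → side p ≢ side p' →
                     Disjoint (listing (cross g p h)) (listing (cross g p' h))
    cross-disjoint sides zero zero eq = sides (cong side (cong proj₂ eq))
    cross-disjoint {g} {h} sides zero (suc y) eq = Finₚ.punchInᵢ≢i g h (sym (cong proj₁ eq))
    cross-disjoint {g} {h} sides (suc y) zero eq = Finₚ.punchInᵢ≢i g h (cong proj₁ eq)
    cross-disjoint {g} {h} sides (suc y) (suc y') eq =
      sides (xor-cancelˡ (orient g (punchIn g h)) (proj₁ (half-injective _ _ (cong proj₂ eq))))

    Ends≈ : Block → Block → Set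
    Ends≈ b b' = let (g , h) = ends b ; (g' , h') = ends b' in (g ≡ g' × h ≡ h') ⊎ (g ≡ h' × h ≡ g')

    shared-vertex⇒ends≈ : ∀ b b' → colour b ≡ colour b' →
                          ∀ i i' → listing b i ≡ listing b' i' → Ends≈ b b'
    shared-vertex⇒ends≈ b b' same i i' shared = ⊕-determines-pair (listing-ends b i)
      (subst (λ v → proj₁ v ≡ proj₁ (ends b') ⊎ proj₁ v ≡ proj₂ (ends b'))
             (sym shared) (listing-ends b' i'))
      (trans (sym (colour-ends b)) (trans (cong proj₁ same) (colour-ends b')))

    inner-cross-disjoint : ∀ {g a g' p h} → colour (inner g a) ≡ colour (cross g' p h) →
                           Disjoint (listing (inner g a)) (listing (cross g' p h))
    inner-cross-disjoint {g} {a} {g'} {p} {h} same i i' shared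
      with shared-vertex⇒ends≈ (inner g a) (cross g' p h) same i i' shared
    ... | inj₁ (refl , g≡) = Finₚ.punchInᵢ≢i g h (sym g≡)
    ... | inj₂ (g≡ , refl) = Finₚ.punchInᵢ≢i g h (sym g≡)

    cross-cross-disjoint : ∀ {g p h g' p' h'} → cross g p h ≢ cross g' p' h' →
                           colour (cross g p h) ≡ colour (cross g' p' h') →
                           Disjoint (listing (cross g p h)) (listing (cross g' p' h'))
    cross-cross-disjoint {g} {p} {h} {g'} {p'} {h'} b≢b' same i i' shared
      with shared-vertex⇒ends≈ (cross g p h) (cross g' p' h') same i i' shared
    ... | inj₁ (refl , H≡) with Finₚ.punchIn-injective g h h' H≡
    ...   | refl = cross-disjoint sides i i' shared
      where
      positions : position p ≡ position p'
      positions = proj₂ (half-injective o o (cong proj₂ same))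
        where o = orient g (punchIn g h)
      sides : side p ≢ side p'
      sides eq = b≢b' (cong (λ q → cross g q h)
        (trans (sym (half-unhalf p)) (trans (cong₂ half eq positions) (half-unhalf p'))))
    cross-cross-disjoint {g} {p} {h} {g'} {p'} {h'} b≢b' same i i' shared
        | inj₂ (refl , H≡) =
      not-¬ (subst (λ H → orient g H ≡ orient g' g) H≡ (proj₁ (half-injective _ _ (cong proj₂ same))))
            (orient-flip (Finₚ.punchInᵢ≢i g' h' ∘ sym))

  colour-classes-disjoint : ∀ b b' → b ≢ b' → colour b ≡ colour b' → Disjoint (listing b) (listing b')
  colour-classes-disjoint (inner g a) (inner g' a') b≢b' same _ _ _
    with ⊕-double-injective {t} {g} {g'} (cong proj₁ same)
  ... | refl = b≢b' (cong (inner g) (Finₚ.suc-injective (cong proj₂ same)))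
  colour-classes-disjoint (inner g a) (cross g' p h) _ same = inner-cross-disjoint same
  colour-classes-disjoint (cross g p h) (inner g' a) _ same i i' shared =
    inner-cross-disjoint (sym same) i' i (sym shared)
  colour-classes-disjoint (cross g p h) (cross g' p' h') b≢b' same = cross-cross-disjoint b≢b' same

  blocks : Fin (s * N + s * ((e + e) * (t + t))) ↔ Block
  blocks = ↔-trans +↔⊎ (↔-trans (*↔× ⊎-↔ ↔-trans *↔× (↔-refl ×-↔ *↔×)) by-kind)
    where
    by-kind : ((Fin s × Fin N) ⊎ (Fin s × Fin (e + e) × Fin (t + t))) ↔ Block
    by-kind = mk↔ₛ′ Sum.[ uncurry inner , (λ (g , p , h) → cross g p h) ]′ kind
                    (λ { (inner g a) → refl ; (cross g p h) → refl })
                    (λ { (inj₁ _) → refl ; (inj₂ _) → refl })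
      where
      kind : Block → (Fin s × Fin N) ⊎ (Fin s × Fin (e + e) × Fin (t + t))
      kind (inner g a) = inj₁ (g , a)
      kind (cross g p h) = inj₂ (g , p , h)

  system : StarSystem (s * (e + e)) e
  system = starSystem *↔× blocks listing listing-injective listing-decomposes

  system-colourable : Colourable system (s * (e + e))
  system-colourable = starSystem-colourable *↔× blocks listing listing-injective listing-decomposes
    (Inverse.from *↔× ∘ colour) λ b b' b≢b' → colour-classes-disjoint b b' b≢b' ∘ from-injective *↔×

↔-injective⇒≤ : ∀ {A B : Set} {a b} → Fin a ↔ A → Fin b ↔ B →
                {f : A → B} → Injective _≡_ _≡_ f → a ≤ b
↔-injective⇒≤ A↔ B↔ f-inj = Finₚ.injective⇒≤ (to-injective A↔ ∘ f-inj ∘ from-injective B↔)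

module _ {n e : ℕ} where

  disjoint⇒≤ : (s s' : Star n e) → VertexDisjoint s s' → suc e + suc e ≤ n
  disjoint⇒≤ s s' disjoint = ↔-injective⇒≤ +↔⊎ ↔-refl {Sum.[ vertex s , vertex s' ]′} injective
    where
    in-s : ∀ i → VertexOf (vertex s i) s
    in-s i = Equivalence.from (vertexOf⇔ s (λ _ → refl)) (i , refl)
    in-s' : ∀ i → VertexOf (vertex s' i) s'
    in-s' i = Equivalence.from (vertexOf⇔ s' (λ _ → refl)) (i , refl)
    injective : Injective _≡_ _≡_ Sum.[ vertex s , vertex s' ]′
    injective {inj₁ i} {inj₁ j} eq = cong inj₁ (vertex-injective s eq)
    injective {inj₁ i} {inj₂ j} eq = ⊥-elim (disjoint _ (in-s i) (subst (λ v → VertexOf v s') (sym eq) (in-s' j)))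
    injective {inj₂ i} {inj₁ j} eq = ⊥-elim (disjoint _ (in-s j) (subst (λ v → VertexOf v s') eq (in-s' i)))
    injective {inj₂ i} {inj₂ j} eq = cong inj₂ (vertex-injective s' eq)

-- Each block yields 2e ordered pairs (centre, leaf) and (leaf, centre), and every ordered pair of
-- distinct vertices arises exactly once.
module _ {n e : ℕ} (S : StarSystem (suc n) e) where

  private
    Dart : Set
    Dart = Fin (m S) × Fin e × Bool

    darts : Fin (m S * (e * 2)) ↔ Dart
    darts = ↔-trans *↔× (↔-refl ×-↔ ↔-trans *↔× (↔-refl ×-↔ Finₚ.2↔Bool))

    dart : Dart → Fin (suc n) × Fin (suc n)
    dart (i , j , false) = vertex (block S i) zero , vertex (block S i) (suc j)
    dart (i , j , true) = vertex (block S i) (suc j) , vertex (block S i) zero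

    dart-edge : ∀ d → EdgeOf (proj₁ (dart d)) (proj₂ (dart d)) (block S (proj₁ d))
    dart-edge (i , j , false) = Equivalence.from (edgeOf⇔ (block S i) (λ _ → refl)) (inj₁ (refl , j , refl))
    dart-edge (i , j , true) = Equivalence.from (edgeOf⇔ (block S i) (λ _ → refl)) (inj₂ (refl , j , refl))

    dart-distinct : ∀ d → proj₁ (dart d) ≢ proj₂ (dart d)
    dart-distinct (i , j , false) eq with vertex-injective (block S i) {zero} {suc j} eq
    ... | ()
    dart-distinct (i , j , true) eq with vertex-injective (block S i) {suc j} {zero} eq
    ... | ()

    block-unique : ∀ {u v i j} → u ≢ v → EdgeOf u v (block S i) → EdgeOf u v (block S j) → i ≡ j
    block-unique {u} {v} u≢v edge edge' with partition S u v u≢v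
    ... | _ , _ , unique = trans (unique _ edge) (sym (unique _ edge'))

    dart-injective : Injective _≡_ _≡_ dart
    dart-injective {i , j , b} {i' , j' , b'} eq
      with block-unique (dart-distinct (i , j , b)) (dart-edge (i , j , b))
             (subst (λ (u , v) → EdgeOf u v (block S i')) (sym eq) (dart-edge (i' , j' , b')))
    ... | refl = same-block b b' eq
      where
      same-block : ∀ b b' → dart (i , j , b) ≡ dart (i , j' , b') → (i , j , b) ≡ (i , j' , b')
      same-block false false eq with vertex-injective (block S i) {suc j} {suc j'} (cong proj₂ eq)
      ... | refl = refl
      same-block true true eq with vertex-injective (block S i) {suc j} {suc j'} (cong proj₁ eq)
      ... | refl = refl
      same-block false true eq with vertex-injective (block S i) {zero} {suc j'} (cong proj₁ eq)
      ... | ()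
      same-block true false eq with vertex-injective (block S i) {suc j} {zero} (cong proj₁ eq)
      ... | ()

    pair : Fin (suc n) × Fin n → Fin (suc n) × Fin (suc n)
    pair (u , w) = u , punchIn u w

    pair-injective : Injective _≡_ _≡_ pair
    pair-injective {u , w} {u' , w'} eq with cong proj₁ eq
    ... | refl = cong (u ,_) (Finₚ.punchIn-injective u w w' (cong proj₂ eq))

    dart-of-pair : ∀ p → Σ Dart λ d → dart d ≡ pair p
    dart-of-pair (u , w) with partition S u (punchIn u w) (Finₚ.punchInᵢ≢i u w ∘ sym)
    ... | i , edge , _ with Equivalence.to (edgeOf⇔ (block S i) (λ _ → refl)) edge
    ...   | inj₁ (c , j , l) = (i , j , false) , cong₂ _,_ c l
    ...   | inj₂ (c , j , l) = (i , j , true) , cong₂ _,_ l c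

  edge-count : m S * (e * 2) ≡ suc n * n
  edge-count = ≤-antisym
    (↔-injective⇒≤ darts *↔× {λ d → proj₁ (dart d) , punchOut (dart-distinct d)} λ {d} {d'} eq →
      dart-injective (cong₂ _,_ (cong proj₁ eq)
        (trans (sym (Finₚ.punchIn-punchOut (dart-distinct d)))
        (trans (cong (λ (u , w) → punchIn u w) eq) (Finₚ.punchIn-punchOut (dart-distinct d'))))))
    (↔-injective⇒≤ *↔× darts {proj₁ ∘ dart-of-pair} λ {p} {p'} eq →
      pair-injective (trans (sym (proj₂ (dart-of-pair p))) (trans (cong dart eq) (proj₂ (dart-of-pair p')))))

module _ {n e : ℕ} (S : StarSystem n e) where

  Intersecting : Set
  Intersecting = ∀ i j → i ≢ j → ¬ VertexDisjoint (block S i) (block S j)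

  colourable-≥ : ∀ {k} → m S ≤ k → Colourable S k
  colourable-≥ m≤k = (λ i → Fin.inject≤ i m≤k) ,
    λ i j i≢j eq → ⊥-elim (i≢j (Finₚ.inject≤-injective _ _ i j eq))

  intersecting-colourable⇒≤ : ∀ {k} → Intersecting → Colourable S k → m S ≤ k
  intersecting-colourable⇒≤ intersecting (c , classes) = Finₚ.injective⇒≤ {f = c} injective
    where
    injective : Injective _≡_ _≡_ c
    injective {i} {j} eq with i Finₚ.≟ j
    ... | yes i≡j = i≡j
    ... | no i≢j = ⊥-elim (intersecting i j i≢j (classes i j i≢j eq))

  intersecting-chromatic : Intersecting → ∀ k → m S ≡ k → Chromatic S k
  intersecting-chromatic _ zero m≡0 = colourable-≥ (≤-reflexive m≡0)
  intersecting-chromatic intersecting (suc k) m≡1+k = colourable-≥ (≤-reflexive m≡1+k) ,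
    λ colourable → 1+n≰n (subst (_≤ k) m≡1+k (intersecting-colourable⇒≤ intersecting colourable))

order-2e-chromatic : ∀ e (S : StarSystem (2 * suc e) (suc e)) → Chromatic S (2 * suc e ∸ 1)
order-2e-chromatic e S = intersecting-chromatic S intersecting _ blocks≡
  where
  intersecting : Intersecting S
  intersecting i j _ disjoint = ≤⇒≯ (disjoint⇒≤ (block S i) (block S j) disjoint)
    (+-mono-< (n<1+n (suc e)) (≤-<-trans (≤-reflexive (+-identityʳ (suc e))) (n<1+n (suc e))))
  blocks≡ : m S ≡ 2 * suc e ∸ 1
  blocks≡ = *-cancelʳ-≡ (m S) (2 * suc e ∸ 1) (suc e * 2) (trans (edge-count S) (regroup e))
    where
    regroup : ∀ e → 2 * suc e * (e + 1 * suc e) ≡ (e + 1 * suc e) * (suc e * 2)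
    regroup = solve-∀

theorem3p3 : (e n : ℕ) → 3 ≤ e → 0 < n → CongMod n (2 * e) (4 * e) →
    (2 * e < n → Σ (StarSystem n e) λ S → Colourable S n) ×
    (n ≡ 2 * e → (S : StarSystem n e) → Chromatic S (n ∸ 1))
theorem3p3 (suc k) n (s≤s _) _ (t , n≡) = (λ _ → construction) , λ { refl → order-2e-chromatic k }
  where
  open Construction t k
  groups : ∀ t k → 2 * suc k + t * (4 * suc k) ≡ suc (t + t) * (suc k + suc k)
  groups = solve-∀
  -- the construction also covers n = 2e
  construction : Σ (StarSystem n e) λ S → Colourable S n
  construction rewrite trans n≡ (groups t k) = system , system-colourable
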